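{- Let $H$ be a finite simple graph with at least one vertex such that either $H$ is an empty (edgeless) graph, or every component of $H$ is a complete graph and at most two components of $H$ have more than one vertex (equivalently, $H\cong K_{m_1}\cup K_{m_2}\cup rK_1$ for some integers $m_1,m_2,r\ge 0$). Then $\omega(H)=\psi(H)$.
   Context: $\omega(H)$ is the clique number of $H$. A vertex coloring $\varsigma: V(H)\to\{1,\dots,k\}$ (not necessarily proper) is complete if for every pair of distinct colors $i\neq j$ there is an edge whose end vertices receive colors $i$ and $j$; the pseudoachromatic number $\psi(H)$ is the maximum $k$ for which a complete coloring of $H$ with $k$ colors exists. $rK_1$ denotes $r$ isolated vertices and $\cup$ denotes disjoint union. -}

module Defs where

open import Data.Nat using (ℕ; _≤_)
open import Data.Fin using (Fin; zero; suc)
open import Data.Product using (Σ; _×_; ∃)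
open import Relation.Binary.PropositionalEquality using (_≡_; _≢_)
open import Relation.Nullary using (¬_)
open import Function.Bundles using (_⇔_)
open import Function.Definitions using (Injective; Surjective)

record Graph (n : ℕ) : Set₁ where
  field
    Adj   : Fin n → Fin n → Set
    sym   : ∀ {u v} → Adj u v → Adj v u
    irrfl : ∀ {u} → ¬ Adj u u
open Graph public

IsMaximum : (ℕ → Set) → ℕ → Set
IsMaximum P k = P k × (∀ j → P j → j ≤ k)

HasClique : ∀ {n} → Graph n → ℕ → Set
HasClique {n} H k =
  Σ (Fin k → Fin n) λ f → Injective _≡_ _≡_ f × (∀ i j → i ≢ j → Adj H (f i) (f j))

CliqueNumber : ∀ {n} → Graph n → ℕ → Set
CliqueNumber H w = IsMaximum (HasClique H) w

-- complete coloring with exactly k colors (every color used), not necessarily proper: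
-- every pair of distinct colors appears on the ends of some edge
IsCompleteColoring : ∀ {n} → Graph n → (k : ℕ) → (Fin n → Fin k) → Set
IsCompleteColoring {n} H k c =
  Surjective _≡_ _≡_ c ×
  (∀ (i j : Fin k) → i ≢ j → Σ (Fin n) λ u → Σ (Fin n) λ v → Adj H u v × c u ≡ i × c v ≡ j)

HasCompleteColoring : ∀ {n} → Graph n → ℕ → Set
HasCompleteColoring {n} H k = Σ (Fin n → Fin k) (IsCompleteColoring H k)

PseudoachromaticNumber : ∀ {n} → Graph n → ℕ → Set
PseudoachromaticNumber H p = IsMaximum (HasCompleteColoring H) p

-- block 0 and block 1 are the (possibly empty) complete graphs K_{m1}, K_{m2};
-- block 2 holds the r isolated vertices
isolatedBlock : Fin 3
isolatedBlock = suc (suc zero)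

IsTwoCliquesPlusIsolated : ∀ {n} → Graph n → Set
IsTwoCliquesPlusIsolated {n} H =
  Σ (Fin n → Fin 3) λ p →
    ∀ u v → u ≢ v → (Adj H u v ⇔ (p u ≡ p v × p u ≢ isolatedBlock))

-- Every edge of H lies inside one of the two cliques B₀, B₁, so a clique with at
-- least two vertices lies inside one of them. In a complete colouring with at least
-- two colours, either every colour occurs on B₀, or some colour a misses B₀; then
-- each edge witnessing a pair {a, x} runs inside B₁, so every colour occurs on B₁.
-- Choosing one vertex per colour, ψ(H) ≤ max(1, |B₀|, |B₁|). Conversely the larger
-- clique B has ω(H) ≥ |B|, and colouring B injectively and every other vertex with
-- one fixed colour is complete, so ψ(H) ≥ |B|.
module Submission where

open import Defs hiding (sym)
open import Data.Nat using (ℕ; zero; suc; _≤_; z≤n; s≤s)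
open import Data.Nat.Properties using (≤-trans; ≤-refl; ≤-total)
open import Data.Fin using (Fin; zero; suc; _≟_)
open import Data.Fin.Properties using (injective⇒≤; ¬∀⟶∃¬; any?; all?; suc-injective)
open import Data.Product using (Σ; _×_; _,_; proj₁; proj₂; ∃)
open import Data.Sum using (inj₁; inj₂)
open import Data.Empty using (⊥-elim)
open import Relation.Binary.PropositionalEquality
open import Relation.Nullary using (¬_; Dec; yes; no)
open import Relation.Nullary.Decidable using (_×-dec_)
open import Function.Bundles using (_⇔_; Equivalence)
open import Function.Definitions using (Injective)

record Enumeration {N : ℕ} (P : Fin N → Set) : Set where
  field
    size           : ℕ
    elem           : Fin size → Fin N
    elem-injective : Injective _≡_ _≡_ elem
    elem-∈         : ∀ i → P (elem i)
    index          : ∀ u → P u → Fin size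
    elem-index     : ∀ u (pu : P u) → elem (index u pu) ≡ u
open Enumeration

enumeration-[] : (P : Fin 0 → Set) → Enumeration P
enumeration-[] P .size = 0
enumeration-[] P .elem ()
enumeration-[] P .elem-injective {()}
enumeration-[] P .elem-∈ ()
enumeration-[] P .index ()
enumeration-[] P .elem-index ()

enumeration-∷ : ∀ {N} {P : Fin (suc N) → Set} →
  P zero → Enumeration (λ u → P (suc u)) → Enumeration P
enumeration-∷ p₀ E .size = suc (size E)
enumeration-∷ p₀ E .elem zero = zero
enumeration-∷ p₀ E .elem (suc i) = suc (elem E i)
enumeration-∷ p₀ E .elem-injective {zero} {zero} _ = refl
enumeration-∷ p₀ E .elem-injective {suc i} {suc j} eq =
  cong suc (elem-injective E (suc-injective eq))
enumeration-∷ p₀ E .elem-∈ zero = p₀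
enumeration-∷ p₀ E .elem-∈ (suc i) = elem-∈ E i
enumeration-∷ p₀ E .index zero _ = zero
enumeration-∷ p₀ E .index (suc u) pu = suc (index E u pu)
enumeration-∷ p₀ E .elem-index zero _ = refl
enumeration-∷ p₀ E .elem-index (suc u) pu = cong suc (elem-index E u pu)

enumeration-skip : ∀ {N} {P : Fin (suc N) → Set} →
  ¬ P zero → Enumeration (λ u → P (suc u)) → Enumeration P
enumeration-skip ¬p₀ E .size = size E
enumeration-skip ¬p₀ E .elem i = suc (elem E i)
enumeration-skip ¬p₀ E .elem-injective eq = elem-injective E (suc-injective eq)
enumeration-skip ¬p₀ E .elem-∈ i = elem-∈ E i
enumeration-skip ¬p₀ E .index zero p₀ = ⊥-elim (¬p₀ p₀)
enumeration-skip ¬p₀ E .index (suc u) pu = index E u pu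
enumeration-skip ¬p₀ E .elem-index zero p₀ = ⊥-elim (¬p₀ p₀)
enumeration-skip ¬p₀ E .elem-index (suc u) pu = cong suc (elem-index E u pu)

enumerate : ∀ {N} (P : Fin N → Set) → (∀ u → Dec (P u)) → Enumeration P
enumerate {zero} P P? = enumeration-[] P
enumerate {suc N} P P? with P? zero
... | yes p₀ = enumeration-∷ p₀ (enumerate (λ u → P (suc u)) (λ u → P? (suc u)))
... | no ¬p₀ = enumeration-skip ¬p₀ (enumerate (λ u → P (suc u)) (λ u → P? (suc u)))

injection-≤-size : ∀ {N j} {P : Fin N → Set} (E : Enumeration P) (g : Fin j → Fin N) →
  Injective _≡_ _≡_ g → (∀ i → P (g i)) → j ≤ size E
injection-≤-size E g g-injective g-∈ = injective⇒≤ index∘g-injective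
  where
  index∘g-injective : Injective _≡_ _≡_ (λ i → index E (g i) (g-∈ i))
  index∘g-injective {x} {y} eq = g-injective (begin
    g x                                ≡⟨ sym (elem-index E (g x) (g-∈ x)) ⟩
    elem E (index E (g x) (g-∈ x))     ≡⟨ cong (elem E) eq ⟩
    elem E (index E (g y) (g-∈ y))     ≡⟨ elem-index E (g y) (g-∈ y) ⟩
    g y                                ∎)
    where open ≡-Reasoning

singleton-clique : ∀ {n} (H : Graph (suc n)) → HasClique H 1
singleton-clique H = (λ _ → zero) , (λ { {zero} {zero} _ → refl }) ,
  λ { zero zero 0≢0 → ⊥-elim (0≢0 refl) }

monochromatic-completeColoring : ∀ {n} (H : Graph (suc n)) → HasCompleteColoring H 1
monochromatic-completeColoring H = (λ _ → zero) , (λ { zero → zero , λ _ → refl }) ,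
  λ { zero zero 0≢0 → ⊥-elim (0≢0 refl) }

another : ∀ {k} → Fin (suc (suc k)) → Fin (suc (suc k))
another zero = suc zero
another (suc _) = zero

≢-another : ∀ {k} (x : Fin (suc (suc k))) → x ≢ another x
≢-another zero ()
≢-another (suc x) ()

module TwoCliquesPlusIsolated {n : ℕ} (H : Graph (suc n)) (p : Fin (suc n) → Fin 3)
  (p-adj : ∀ u v → u ≢ v → (Adj H u v ⇔ (p u ≡ p v × p u ≢ isolatedBlock))) where

  InBlock : Fin 3 → Fin (suc n) → Set
  InBlock b u = p u ≡ b

  BlockInjection : Fin 3 → ℕ → Set
  BlockInjection b j =
    Σ (Fin j → Fin (suc n)) λ g → Injective _≡_ _≡_ g × (∀ i → InBlock b (g i))

  adjacent⇒sameBlock : ∀ {u v} → Adj H u v → p u ≡ p v × p u ≢ isolatedBlock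
  adjacent⇒sameBlock {u} {v} a =
    Equivalence.to (p-adj u v (λ { refl → irrfl H a })) a

  sameBlock⇒adjacent : ∀ {u v} → u ≢ v → p u ≡ p v → p u ≢ isolatedBlock → Adj H u v
  sameBlock⇒adjacent {u} {v} u≢v same ¬iso = Equivalence.from (p-adj u v u≢v) (same , ¬iso)

  block-clique : ∀ {b} → b ≢ isolatedBlock → (E : Enumeration (InBlock b)) →
    HasClique H (size E)
  block-clique b≢iso E = elem E , elem-injective E , λ i j i≢j →
    sameBlock⇒adjacent (λ eq → i≢j (elem-injective E eq))
      (trans (elem-∈ E i) (sym (elem-∈ E j)))
      (λ eq → b≢iso (trans (sym (elem-∈ E i)) eq))

  block-completeColoring : ∀ {b} → b ≢ isolatedBlock → (E : Enumeration (InBlock b)) →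
    Fin (size E) → HasCompleteColoring H (size E)
  block-completeColoring {b} b≢iso E d = c , surjective , complete
    where
    colour : ∀ u → Dec (InBlock b u) → Fin (size E)
    colour u (yes u∈b) = index E u u∈b
    colour u (no _) = d

    c : Fin (suc n) → Fin (size E)
    c u = colour u (p u ≟ b)

    c∘elem : ∀ i → c (elem E i) ≡ i
    c∘elem i with p (elem E i) ≟ b
    ... | yes e∈b = elem-injective E (elem-index E (elem E i) e∈b)
    ... | no e∉b = ⊥-elim (e∉b (elem-∈ E i))

    surjective : ∀ i → ∃ λ u → ∀ {v} → v ≡ u → c v ≡ i
    surjective i = elem E i , λ { refl → c∘elem i }

    complete : ∀ i j → i ≢ j → Σ (Fin (suc n)) λ u → Σ (Fin (suc n)) λ v →
      Adj H u v × c u ≡ i × c v ≡ j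
    complete i j i≢j =
      elem E i , elem E j , proj₂ (proj₂ (block-clique b≢iso E)) i j i≢j , c∘elem i , c∘elem j

  clique⇒blockInjection : ∀ {j} → HasClique H (suc (suc j)) →
    ∃ λ b → b ≢ isolatedBlock × BlockInjection b (suc (suc j))
  clique⇒blockInjection (f , f-injective , f-adj) =
    p (f zero) , proj₂ (adjacent⇒sameBlock (f-adj zero (suc zero) (λ ()))) ,
    f , f-injective , inBlock
    where
    inBlock : ∀ i → InBlock (p (f zero)) (f i)
    inBlock i with i ≟ zero
    ... | yes refl = refl
    ... | no i≢0 = sym (proj₁ (adjacent⇒sameBlock (f-adj zero i (λ eq → i≢0 (sym eq)))))

  colourRepresentatives : ∀ {k} (c : Fin (suc n) → Fin k) b →
    (∀ x → ∃ λ u → InBlock b u × c u ≡ x) → BlockInjection b k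
  colourRepresentatives c b rep =
    (λ x → proj₁ (rep x)) , injective , (λ x → proj₁ (proj₂ (rep x)))
    where
    injective : Injective _≡_ _≡_ (λ x → proj₁ (rep x))
    injective {x} {y} eq =
      trans (sym (proj₂ (proj₂ (rep x)))) (trans (cong c eq) (proj₂ (proj₂ (rep y))))

  occursInBlock? : ∀ {k} (c : Fin (suc n) → Fin k) b x → Dec (∃ λ u → InBlock b u × c u ≡ x)
  occursInBlock? c b x = any? (λ u → (p u ≟ b) ×-dec (c u ≟ x))

  completeColoring⇒blockInjection : ∀ {k} → HasCompleteColoring H (suc (suc k)) →
    ∃ λ b → b ≢ isolatedBlock × BlockInjection b (suc (suc k))
  completeColoring⇒blockInjection (c , _ , complete) with all? (occursInBlock? c zero)
  ... | yes allIn₀ = zero , (λ ()) , colourRepresentatives c zero allIn₀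
  ... | no ¬allIn₀ with ¬∀⟶∃¬ _ _ (occursInBlock? c zero) ¬allIn₀
  ...   | a , a∉B₀ = suc zero , (λ ()) , colourRepresentatives c (suc zero) allIn₁
    where
    a-coloured⇒InB₁ : ∀ u → c u ≡ a → p u ≢ isolatedBlock → InBlock (suc zero) u
    a-coloured⇒InB₁ u cu≡a ¬iso with p u in pu≡
    ... | zero = ⊥-elim (a∉B₀ (u , pu≡ , cu≡a))
    ... | suc zero = refl
    ... | suc (suc zero) = ⊥-elim (¬iso refl)

    allIn₁ : ∀ x → ∃ λ u → InBlock (suc zero) u × c u ≡ x
    allIn₁ x with x ≟ a
    ... | yes refl with complete x (another x) (≢-another x)
    ...   | u , _ , uv , cu≡x , _ =
            u , a-coloured⇒InB₁ u cu≡x (proj₂ (adjacent⇒sameBlock uv)) , cu≡x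
    allIn₁ x | no x≢a with complete a x (λ eq → x≢a (sym eq))
    ...   | u , v , uv , cu≡a , cv≡x =
            v , trans (sym (proj₁ (adjacent⇒sameBlock uv)))
                      (a-coloured⇒InB₁ u cu≡a (proj₂ (adjacent⇒sameBlock uv))) , cv≡x

  E₀ : Enumeration (InBlock zero)
  E₀ = enumerate (InBlock zero) (λ u → p u ≟ zero)

  E₁ : Enumeration (InBlock (suc zero))
  E₁ = enumerate (InBlock (suc zero)) (λ u → p u ≟ suc zero)

  module BoundedBy (M : ℕ) (1≤M : 1 ≤ M) (E₀≤M : size E₀ ≤ M) (E₁≤M : size E₁ ≤ M) where

    blockInjection-≤ : ∀ {b j} → b ≢ isolatedBlock → BlockInjection b j → j ≤ M
    blockInjection-≤ {zero} _ (g , g-inj , g-∈) =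
      ≤-trans (injection-≤-size E₀ g g-inj g-∈) E₀≤M
    blockInjection-≤ {suc zero} _ (g , g-inj , g-∈) =
      ≤-trans (injection-≤-size E₁ g g-inj g-∈) E₁≤M
    blockInjection-≤ {suc (suc zero)} b≢iso _ = ⊥-elim (b≢iso refl)

    ≤-bound : (Q : ℕ → Set) →
      (∀ {j} → Q (suc (suc j)) → ∃ λ b → b ≢ isolatedBlock × BlockInjection b (suc (suc j))) →
      ∀ j → Q j → j ≤ M
    ≤-bound Q _ zero _ = z≤n
    ≤-bound Q _ (suc zero) _ = 1≤M
    ≤-bound Q inBlock (suc (suc j)) q with inBlock q
    ... | _ , b≢iso , g = blockInjection-≤ b≢iso g

    cliqueNumber : HasClique H M → CliqueNumber H M
    cliqueNumber ω = ω , ≤-bound (HasClique H) clique⇒blockInjection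

    pseudoachromaticNumber : HasCompleteColoring H M → PseudoachromaticNumber H M
    pseudoachromaticNumber ψ = ψ , ≤-bound (HasCompleteColoring H) completeColoring⇒blockInjection

  ω≡ψ-largestBlock : ∀ {b} → b ≢ isolatedBlock → (E : Enumeration (InBlock b)) →
    size E₀ ≤ size E → size E₁ ≤ size E →
    Σ ℕ λ w → CliqueNumber H w × PseudoachromaticNumber H w
  ω≡ψ-largestBlock b≢iso E E₀≤E E₁≤E with size E in size≡
  ... | zero = 1 , cliqueNumber (singleton-clique H) ,
                   pseudoachromaticNumber (monochromatic-completeColoring H)
    where open BoundedBy 1 ≤-refl (≤-trans E₀≤E z≤n) (≤-trans E₁≤E z≤n)
  ... | suc t = suc t , cliqueNumber (subst (HasClique H) size≡ (block-clique b≢iso E)) ,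
                        pseudoachromaticNumber (subst (HasCompleteColoring H) size≡
                          (block-completeColoring b≢iso E (subst Fin (sym size≡) zero)))
    where open BoundedBy (suc t) (s≤s z≤n) E₀≤E E₁≤E

  ω≡ψ : Σ ℕ λ w → CliqueNumber H w × PseudoachromaticNumber H w
  ω≡ψ with ≤-total (size E₀) (size E₁)
  ... | inj₁ E₀≤E₁ = ω≡ψ-largestBlock (λ ()) E₁ E₀≤E₁ ≤-refl
  ... | inj₂ E₁≤E₀ = ω≡ψ-largestBlock (λ ()) E₀ ≤-refl E₁≤E₀

lemma2 : (n : ℕ) (H : Graph (suc n)) → IsTwoCliquesPlusIsolated H →
    Σ ℕ (λ w → CliqueNumber H w × PseudoachromaticNumber H w)
lemma2 n H (p , p-adj) = TwoCliquesPlusIsolated.ω≡ψ H p p-adj
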